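{- Let $(a_P)_P\in\prod_PR/(P)$ and suppose $\alpha=[(a_P)_P]\in\mathcal{C}^{\mathrm{alg}}_{\mathcal{A}_K}$. Then there are only finitely many $x\in R$ such that $a_P=x\bmod P$ for infinitely many $P$.
   Context: $q$ is a prime power, $R=\mathbb{F}_q[\theta]$, $K=\mathbb{F}_q(\theta)$; $P$ runs over monic irreducible elements of $R$. $\mathcal{A}_K=\big(\prod_PR/(P)\big)/\big(\bigoplus_PR/(P)\big)$ with classes $[(a_P)_P]$; $K$ embeds diagonally (reduction modulo $P$ for $P$ not dividing denominators), making $\mathcal{A}_K$ a $K$-algebra. $\mathcal{C}^{\mathrm{alg}}_{\mathcal{A}_K}$ is the set of $\alpha\in\mathcal{A}_K$ with $f(\alpha)=0$ for some nonzero $f\in K[x]$. -}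

module Defs where

open import Level using (0ℓ)
open import Data.Nat.Base using (ℕ)
open import Data.Product using (Σ; ∃; _×_; _,_)
open import Data.Sum using (_⊎_)
open import Data.List using (List; []; _∷_; _∷ʳ_; map)
open import Data.List.Relation.Unary.All using (All)
open import Data.List.Relation.Unary.Any using (Any)
open import Data.List.Relation.Binary.Pointwise using (Pointwise)
open import Data.List.Membership.Propositional using (_∈_; _∉_)
open import Relation.Nullary using (¬_)
open import Relation.Binary.PropositionalEquality using (_≡_; _≢_)
open import Relation.Binary.Definitions using (DecidableEquality)
open import Algebra.Structures using (IsCommutativeRing)
open import Algebra.Bundles using (RawSemiring)
import Algebra.Definitions.RawSemiring as RSDefs

-- A finite field F_q (every finite field has prime-power order q; we
-- quantify over all finite fields, with propositional equality).

record FiniteField : Set₁ where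
  infixl 7 _*_
  infixl 6 _+_
  field
    Carrier  : Set
    _+_ _*_  : Carrier → Carrier → Carrier
    -_       : Carrier → Carrier
    0# 1#    : Carrier
    isCommutativeRing : IsCommutativeRing _≡_ _+_ _*_ -_ 0# 1#
    0≢1      : 0# ≢ 1#
    inverse  : ∀ x → x ≢ 0# → ∃ λ y → x * y ≡ 1#
    _≟_      : DecidableEquality Carrier
    elements : List Carrier
    complete : ∀ x → x ∈ elements

module Over (F : FiniteField) where
  open FiniteField F renaming (_+_ to _+F_; _*_ to _*F_; -_ to -F_)

  -- R = F[θ]: coefficient lists, lowest degree first.
  Poly : Set
  Poly = List Carrier

  infixl 6 _+ₚ_ _-ₚ_
  infixl 7 _*ₚ_ _·ₚ_
  infix 4 _≈ₚ_

  _+ₚ_ : Poly → Poly → Poly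
  []       +ₚ q        = q
  (a ∷ p)  +ₚ []       = a ∷ p
  (a ∷ p)  +ₚ (b ∷ q)  = (a +F b) ∷ (p +ₚ q)

  -ₚ_ : Poly → Poly
  -ₚ p = map -F_ p

  _-ₚ_ : Poly → Poly → Poly
  p -ₚ q = p +ₚ (-ₚ q)

  _·ₚ_ : Carrier → Poly → Poly
  c ·ₚ p = map (c *F_) p

  _*ₚ_ : Poly → Poly → Poly
  []      *ₚ q = []
  (a ∷ p) *ₚ q = (a ·ₚ q) +ₚ (0# ∷ (p *ₚ q))

  0ₚ 1ₚ : Poly
  0ₚ = []
  1ₚ = 1# ∷ []

  -- equality of polynomials: the difference has all coefficients zero
  -- (so trailing zeros are ignored)
  _≈ₚ_ : Poly → Poly → Set
  p ≈ₚ q = All (_≡ 0#) (p -ₚ q)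

  polyRawSemiring : RawSemiring 0ℓ 0ℓ
  polyRawSemiring = record
    { Carrier = Poly ; _≈_ = _≈ₚ_ ; _+_ = _+ₚ_ ; _*_ = _*ₚ_ ; 0# = 0ₚ ; 1# = 1ₚ }

  open RSDefs polyRawSemiring public using (_∣_; _∤_; Irreducible)

  -- Monic polynomials, in normalised form (leading coefficient exactly 1#
  -- as the last list entry), so each monic polynomial has a unique list.
  Monic : Poly → Set
  Monic p = ∃ λ c → p ≡ c ∷ʳ 1#

  MonicIrreducible : Poly → Set
  MonicIrreducible P = Monic P × Irreducible P

  horner : List Poly → Poly → Poly
  horner []       y = 0ₚ
  horner (c ∷ cs) y = c +ₚ (y *ₚ horner cs y)

  -- K = F(θ): fractions num/den with den ≠ 0.
  record Frac : Set where
    constructor _/_[_]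
    field
      num : Poly
      den : Poly
      den≉0 : ¬ (den ≈ₚ 0ₚ)
  open Frac public

  -- c ∈ R represents (mod P) the image of k ∈ K in R/(P) under reduction
  -- modulo P (meaningful when P ∤ den k): den k · c ≡ num k (mod P).
  RepMod : Poly → Frac → Poly → Set
  RepMod P k c = P ∣ ((den k *ₚ c) -ₚ num k)

  -- Elements of ∏_P R/(P): a family P ↦ a_P, each a_P given by a
  -- representative in R (only the values at monic irreducible P matter).
  Family : Set
  Family = Poly → Poly

  -- f ∈ K[x], coefficients lowest degree first; nonzero means some
  -- coefficient is nonzero.
  NonzeroKPoly : List Frac → Set
  NonzeroKPoly f = Any (λ k → ¬ (num k ≈ₚ 0ₚ)) f

  -- The P-component of f(α) vanishes in R/(P): for the reductions c_i of
  -- the coefficients of f modulo P, Σ c_i a_P^i ≡ 0 (mod P).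
  VanishesAt : List Frac → Family → Poly → Set
  VanishesAt f a P = ∀ cs → Pointwise (RepMod P) f cs → P ∣ horner cs (a P)

  -- f(α) = 0 in A_K: the components vanish for all but finitely many P.
  RootInA : List Frac → Family → Set
  RootInA f a = ∃ λ (E : List Poly) →
    ∀ P → MonicIrreducible P → P ∉ E → VanishesAt f a P

  AlgebraicOverK : Family → Set
  AlgebraicOverK a = ∃ λ (f : List Frac) → NonzeroKPoly f × RootInA f a

  -- Finiteness of sets of monic irreducibles (lists are canonical) ...
  FiniteSetOfPrimes : (Poly → Set) → Set
  FiniteSetOfPrimes S = ∃ λ (L : List Poly) → ∀ P → S P → P ∈ L

  InfiniteSetOfPrimes : (Poly → Set) → Set
  InfiniteSetOfPrimes S = ¬ FiniteSetOfPrimes S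

  -- ... and of sets of elements of R (up to equality ≈ₚ in R).
  FiniteSetInR : (Poly → Set) → Set
  FiniteSetInR S = ∃ λ (L : List Poly) → ∀ x → S x → Any (x ≈ₚ_) L

  CongMod : Family → Poly → Poly → Set
  CongMod a x P = P ∣ (a P -ₚ x)

module Submission where

-- Pick a nonzero f ∈ K[x] with f(α) = 0 and a common denominator D of its
-- coefficients, so that h(x) = D·f(x) ∈ R for x ∈ R.  Since R/(P) is a field,
-- f can be reduced modulo every prime P not dividing D; if moreover P lies
-- outside the finite exceptional set of α and a_P ≡ x (mod P), then P ∣ h(x).
-- Once deg x exceeds a bound depending only on f, the top-degree term
-- dominates and h(x) ≠ 0, so only primes of degree at most deg h(x) can occur.
-- Hence every x with a_P ≡ x (mod P) for infinitely many P has bounded degree,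
-- and there are only finitely many such x because F is finite.

open import Defs
open import Level using (0ℓ)
open import Data.Nat.Base as ℕ using (ℕ; zero; suc; z≤n; s≤s; _≤_; _<_; _⊔_)
import Data.Nat.Properties as ℕ
open import Data.Integer.Base as ℤ using (ℤ; +_; -[1+_])
import Data.Integer.Properties as ℤ
open import Data.Sign.Base as Sign using (Sign)
open import Data.Maybe.Base using (Maybe; just; nothing)
open import Data.Product using (Σ; ∃; _×_; _,_; proj₁; proj₂)
open import Data.Sum using (_⊎_; inj₁; inj₂)
open import Data.Empty using (⊥-elim)
open import Relation.Nullary using (¬_)
open import Data.List.Base using (List; []; _∷_; _∷ʳ_; _++_; length; cartesianProductWith)
open import Data.List.Properties using (length-++; ≡-dec)
open import Data.List.Relation.Unary.All using (All; []; _∷_)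
open import Data.List.Relation.Unary.Any as Any using (Any; here; there)
open import Data.List.Membership.Propositional using (_∈_)
open import Data.List.Membership.Propositional.Properties using (∈-++⁺ˡ; ∈-++⁺ʳ; ∈-cartesianProductWith⁺)
open import Data.List.Relation.Binary.Pointwise using (Pointwise; []; _∷_)
open import Relation.Nullary.Decidable using (yes; no)
open import Relation.Binary.PropositionalEquality as ≡ using (_≡_)
open import Algebra.Bundles using (CommutativeRing; RawSemiring)
open import Algebra.Structures using (IsCommutativeRing)
import Algebra.Solver.Ring.AlmostCommutativeRing as ACR
import Relation.Binary.Reasoning.Setoid

module IntegerCoefficientSolver {c ℓ} (R : CommutativeRing c ℓ) where
  open CommutativeRing R
  open import Algebra.Properties.Ring ring using (-0#≈0#; -‿involutive; -‿distribˡ-*; -‿distribʳ-*; -‿+-comm)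
  open import Algebra.Properties.Semiring.Mult.TCOptimised semiring
    using (×-homo-+; ×1-homo-*; 1+×) renaming (_×_ to _×ᵣ_)
  open import Relation.Binary.Reasoning.Setoid setoid
  open import Algebra.Properties.CommutativeSemigroup +-commutativeSemigroup using (interchange)

  -- fromℤ (+ 1) must reduce to 1# itself, because the solver compares its
  -- constant con (+ 1) with the 1# occurring in goals; hence the
  -- multiplication of Mult.TCOptimised, where 1 × x = x.
  fromℤ : ℤ → Carrier
  fromℤ (+ n)      = n ×ᵣ 1#
  fromℤ -[1+ n ]   = - (suc n ×ᵣ 1#)

  private
    fromℕ : ℕ → Carrier
    fromℕ n = n ×ᵣ 1#

    ⊖-homo : ∀ m n → fromℤ (m ℤ.⊖ n) ≈ fromℕ m - fromℕ n
    ⊖-homo m       zero    = sym (trans (+-congˡ -0#≈0#) (+-identityʳ _))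
    ⊖-homo zero    (suc n) = sym (+-identityˡ _)
    ⊖-homo (suc m) (suc n) rewrite ℤ.[1+m]⊖[1+n]≡m⊖n m n = begin
      fromℤ (m ℤ.⊖ n)                         ≈⟨ ⊖-homo m n ⟩
      fromℕ m - fromℕ n                       ≈⟨ sym (+-identityˡ _) ⟩
      0# + (fromℕ m - fromℕ n)                ≈⟨ +-congʳ (sym (-‿inverseʳ 1#)) ⟩
      (1# - 1#) + (fromℕ m - fromℕ n)         ≈⟨ interchange _ _ _ _ ⟩
      (1# + fromℕ m) + (- 1# - fromℕ n)       ≈⟨ +-congˡ (-‿+-comm 1# (fromℕ n)) ⟩
      (1# + fromℕ m) - (1# + fromℕ n)         ≈⟨ +-cong (sym (1+× m 1#)) (-‿cong (sym (1+× n 1#))) ⟩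
      fromℕ (suc m) - fromℕ (suc n)           ∎

    +-homo : ∀ i j → fromℤ (i ℤ.+ j) ≈ fromℤ i + fromℤ j
    +-homo -[1+ m ] -[1+ n ] = begin
      - fromℕ (suc (suc (m ℕ.+ n)))           ≈⟨ -‿cong (reflexive (≡.cong fromℕ (≡.sym (ℕ.+-suc (suc m) n)))) ⟩
      - fromℕ (suc m ℕ.+ suc n)               ≈⟨ -‿cong (×-homo-+ 1# (suc m) (suc n)) ⟩
      - (fromℕ (suc m) + fromℕ (suc n))       ≈⟨ sym (-‿+-comm _ _) ⟩
      - fromℕ (suc m) - fromℕ (suc n)         ∎
    +-homo -[1+ m ] (+ n)    = trans (⊖-homo n (suc m)) (+-comm _ _)
    +-homo (+ m)    -[1+ n ] = ⊖-homo m (suc n)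
    +-homo (+ m)    (+ n)    = ×-homo-+ 1# m n

    -‿homo : ∀ i → fromℤ (ℤ.- i) ≈ - fromℤ i
    -‿homo (+ zero)  = sym -0#≈0#
    -‿homo (+ suc n) = refl
    -‿homo -[1+ n ]  = sym (-‿involutive _)

    signed : Sign → Carrier → Carrier
    signed Sign.+ x = x
    signed Sign.- x = - x

    signed-cong : ∀ s {x y} → x ≈ y → signed s x ≈ signed s y
    signed-cong Sign.+ x≈y = x≈y
    signed-cong Sign.- x≈y = -‿cong x≈y

    fromℤ-◃ : ∀ s n → fromℤ (s ℤ.◃ n) ≈ signed s (fromℕ n)
    fromℤ-◃ Sign.+ zero    = refl
    fromℤ-◃ Sign.- zero    = sym -0#≈0#
    fromℤ-◃ Sign.+ (suc n) = refl
    fromℤ-◃ Sign.- (suc n) = refl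

    fromℤ-signAbs : ∀ i → fromℤ i ≈ signed (ℤ.sign i) (fromℕ ℤ.∣ i ∣)
    fromℤ-signAbs (+ n)    = refl
    fromℤ-signAbs -[1+ n ] = refl

    signed-* : ∀ s t x y → signed (s Sign.* t) (x * y) ≈ signed s x * signed t y
    signed-* Sign.+ Sign.+ x y = refl
    signed-* Sign.+ Sign.- x y = -‿distribʳ-* x y
    signed-* Sign.- Sign.+ x y = -‿distribˡ-* x y
    signed-* Sign.- Sign.- x y = begin
      x * y              ≈⟨ sym (-‿involutive _) ⟩
      - - (x * y)        ≈⟨ -‿cong (-‿distribˡ-* x y) ⟩
      - (- x * y)        ≈⟨ -‿distribʳ-* (- x) y ⟩
      - x * - y          ∎

    *-homo : ∀ i j → fromℤ (i ℤ.* j) ≈ fromℤ i * fromℤ j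
    *-homo i j = begin
      fromℤ (s ℤ.◃ ℤ.∣ i ∣ ℕ.* ℤ.∣ j ∣)                           ≈⟨ fromℤ-◃ s (ℤ.∣ i ∣ ℕ.* ℤ.∣ j ∣) ⟩
      signed s (fromℕ (ℤ.∣ i ∣ ℕ.* ℤ.∣ j ∣))                      ≈⟨ signed-cong s (×1-homo-* ℤ.∣ i ∣ ℤ.∣ j ∣) ⟩
      signed s (fromℕ ℤ.∣ i ∣ * fromℕ ℤ.∣ j ∣)                    ≈⟨ signed-* (ℤ.sign i) (ℤ.sign j) _ _ ⟩
      signed (ℤ.sign i) (fromℕ ℤ.∣ i ∣) * signed (ℤ.sign j) (fromℕ ℤ.∣ j ∣)
                                                                 ≈⟨ sym (*-cong (fromℤ-signAbs i) (fromℤ-signAbs j)) ⟩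
      fromℤ i * fromℤ j                                          ∎
      where s = ℤ.sign i Sign.* ℤ.sign j

    morphism : ℤ.+-*-rawRing ACR.-Raw-AlmostCommutative⟶ ACR.fromCommutativeRing R
    morphism = record
      { ⟦_⟧ = fromℤ ; +-homo = +-homo ; *-homo = *-homo ; -‿homo = -‿homo
      ; 0-homo = refl ; 1-homo = refl }

    _≟fromℤ_ : ∀ i j → Maybe (fromℤ i ≈ fromℤ j)
    i ≟fromℤ j with i ℤ.≟ j
    ... | yes ≡.refl = just refl
    ... | no _       = nothing

  open import Algebra.Solver.Ring ℤ.+-*-rawRing (ACR.fromCommutativeRing R) morphism _≟fromℤ_ public

-- The polynomial ring R = F[θ]

module PolynomialsOver (F : FiniteField) where
  open ≡ using (_≢_; refl; sym; trans; cong; cong₂)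
  open FiniteField F using (Carrier; 0#; 1#; isCommutativeRing; 0≢1; inverse; _≟_; elements; complete)
  open import Data.List.Membership.DecPropositional (≡-dec _≟_) using (_∈?_)
  open Over F

  fieldRing : CommutativeRing 0ℓ 0ℓ
  fieldRing = record { isCommutativeRing = isCommutativeRing }

  module 𝔽 where
    open CommutativeRing fieldRing public
    open import Algebra.Properties.Ring ring public using (-0#≈0#)
    open import Algebra.Properties.Group +-group public using (x∙y⁻¹≈ε⇒x≈y)
    open import Algebra.Properties.CommutativeSemigroup +-commutativeSemigroup public using (interchange)
    open import Algebra.Properties.CommutativeSemigroup *-commutativeSemigroup public using (xy∙z≈y∙xz)

  *-nonzero : ∀ {a b} → a ≢ 0# → b ≢ 0# → a 𝔽.* b ≢ 0#
  *-nonzero {a} {b} a≢0 b≢0 ab≡0 with inverse a a≢0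
  ... | a⁻¹ , aa⁻¹≡1 = b≢0 (begin
    b                    ≡⟨ sym (𝔽.*-identityˡ b) ⟩
    1# 𝔽.* b             ≡⟨ cong (𝔽._* b) (sym aa⁻¹≡1) ⟩
    (a 𝔽.* a⁻¹) 𝔽.* b    ≡⟨ 𝔽.xy∙z≈y∙xz a a⁻¹ b ⟩
    a⁻¹ 𝔽.* (a 𝔽.* b)    ≡⟨ cong (a⁻¹ 𝔽.*_) ab≡0 ⟩
    a⁻¹ 𝔽.* 0#           ≡⟨ 𝔽.zeroʳ a⁻¹ ⟩
    0#                   ∎)
    where open ≡.≡-Reasoning

  coeff : Poly → ℕ → Carrier
  coeff []      _       = 0#
  coeff (a ∷ p) zero    = a
  coeff (a ∷ p) (suc n) = coeff p n

  coeff-+ₚ : ∀ p q n → coeff (p +ₚ q) n ≡ coeff p n 𝔽.+ coeff q n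
  coeff-+ₚ []      q       n       = sym (𝔽.+-identityˡ (coeff q n))
  coeff-+ₚ (a ∷ p) []      n       = sym (𝔽.+-identityʳ (coeff (a ∷ p) n))
  coeff-+ₚ (a ∷ p) (b ∷ q) zero    = refl
  coeff-+ₚ (a ∷ p) (b ∷ q) (suc n) = coeff-+ₚ p q n

  coeff-·ₚ : ∀ c p n → coeff (c ·ₚ p) n ≡ c 𝔽.* coeff p n
  coeff-·ₚ c []      n       = sym (𝔽.zeroʳ c)
  coeff-·ₚ c (a ∷ p) zero    = refl
  coeff-·ₚ c (a ∷ p) (suc n) = coeff-·ₚ c p n

  coeff-negₚ : ∀ p n → coeff (-ₚ p) n ≡ 𝔽.- coeff p n
  coeff-negₚ []      n       = sym 𝔽.-0#≈0#
  coeff-negₚ (a ∷ p) zero    = refl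
  coeff-negₚ (a ∷ p) (suc n) = coeff-negₚ p n

  coeff--ₚ : ∀ p q n → coeff (p -ₚ q) n ≡ coeff p n 𝔽.- coeff q n
  coeff--ₚ p q n = trans (coeff-+ₚ p (-ₚ q) n) (cong (coeff p n 𝔽.+_) (coeff-negₚ q n))

  -- Equivalent to _≈ₚ_ (≈ₚ⇒≋, ≋⇒≈ₚ), but a record, so that Agda can infer
  -- its arguments; it is the equality of the ring structure on Poly.
  infix 4 _≋_
  record _≋_ (p q : Poly) : Set where
    constructor coeffwise
    field coeff-≡ : ∀ n → coeff p n ≡ coeff q n
  open _≋_ public

  ≋-refl : ∀ {p} → p ≋ p
  ≋-refl = coeffwise λ _ → refl

  ≋-sym : ∀ {p q} → p ≋ q → q ≋ p
  ≋-sym p≋q = coeffwise λ n → sym (coeff-≡ p≋q n)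

  ≋-trans : ∀ {p q r} → p ≋ q → q ≋ r → p ≋ r
  ≋-trans p≋q q≋r = coeffwise λ n → trans (coeff-≡ p≋q n) (coeff-≡ q≋r n)

  private
    All≡0⇒coeff≡0 : ∀ {p} → All (_≡ 0#) p → ∀ n → coeff p n ≡ 0#
    All≡0⇒coeff≡0 []         n       = refl
    All≡0⇒coeff≡0 (a≡0 ∷ _)  zero    = a≡0
    All≡0⇒coeff≡0 (_ ∷ p≡0)  (suc n) = All≡0⇒coeff≡0 p≡0 n

    coeff≡0⇒All≡0 : ∀ p → (∀ n → coeff p n ≡ 0#) → All (_≡ 0#) p
    coeff≡0⇒All≡0 []      p≡0 = []
    coeff≡0⇒All≡0 (a ∷ p) p≡0 = p≡0 zero ∷ coeff≡0⇒All≡0 p (λ n → p≡0 (suc n))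

  ≈ₚ⇒≋ : ∀ {p q} → p ≈ₚ q → p ≋ q
  ≈ₚ⇒≋ {p} {q} p≈q = coeffwise λ n →
    𝔽.x∙y⁻¹≈ε⇒x≈y _ _ (trans (sym (coeff--ₚ p q n)) (All≡0⇒coeff≡0 p≈q n))

  ≋⇒≈ₚ : ∀ {p q} → p ≋ q → p ≈ₚ q
  ≋⇒≈ₚ {p} {q} p≋q = coeff≡0⇒All≡0 _ λ n →
    trans (coeff--ₚ p q n) (trans (cong (𝔽._- coeff q n) (coeff-≡ p≋q n)) (𝔽.-‿inverseʳ _))

  +ₚ-cong : ∀ {p p' q q'} → p ≋ p' → q ≋ q' → p +ₚ q ≋ p' +ₚ q'
  +ₚ-cong {p} {p'} {q} {q'} p≋p' q≋q' = coeffwise λ n →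
    trans (coeff-+ₚ p q n) (trans (cong₂ 𝔽._+_ (coeff-≡ p≋p' n) (coeff-≡ q≋q' n)) (sym (coeff-+ₚ p' q' n)))

  ·ₚ-congʳ : ∀ {c d p} → c ≡ d → c ·ₚ p ≋ d ·ₚ p
  ·ₚ-congʳ refl = ≋-refl

  negₚ-cong : ∀ {p q} → p ≋ q → -ₚ p ≋ -ₚ q
  negₚ-cong {p} {q} p≋q = coeffwise λ n →
    trans (coeff-negₚ p n) (trans (cong 𝔽.-_ (coeff-≡ p≋q n)) (sym (coeff-negₚ q n)))

  ∷-cong : ∀ {a b p q} → a ≡ b → p ≋ q → a ∷ p ≋ b ∷ q
  ∷-cong a≡b p≋q = coeffwise λ { zero → a≡b ; (suc n) → coeff-≡ p≋q n }

  ∷-injectiveʳ : ∀ {a b p q} → a ∷ p ≋ b ∷ q → p ≋ q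
  ∷-injectiveʳ a∷p≋b∷q = coeffwise λ n → coeff-≡ a∷p≋b∷q (suc n)

  0∷[]≋[] : 0# ∷ [] ≋ []
  0∷[]≋[] = coeffwise λ { zero → refl ; (suc n) → refl }

  +ₚ-assoc : ∀ p q r → (p +ₚ q) +ₚ r ≋ p +ₚ (q +ₚ r)
  +ₚ-assoc p q r = coeffwise go where
    go : ∀ n → coeff ((p +ₚ q) +ₚ r) n ≡ coeff (p +ₚ (q +ₚ r)) n
    go n rewrite coeff-+ₚ (p +ₚ q) r n | coeff-+ₚ p q n | coeff-+ₚ p (q +ₚ r) n | coeff-+ₚ q r n = 𝔽.+-assoc _ _ _

  +ₚ-comm : ∀ p q → p +ₚ q ≋ q +ₚ p
  +ₚ-comm p q = coeffwise λ n → trans (coeff-+ₚ p q n) (trans (𝔽.+-comm _ _) (sym (coeff-+ₚ q p n)))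

  +ₚ-identityʳ : ∀ p → p +ₚ [] ≋ p
  +ₚ-identityʳ p = coeffwise λ n → trans (coeff-+ₚ p [] n) (𝔽.+-identityʳ _)

  negₚ-inverseˡ : ∀ p → (-ₚ p) +ₚ p ≋ []
  negₚ-inverseˡ p = coeffwise λ n →
    trans (coeff-+ₚ (-ₚ p) p n) (trans (cong (𝔽._+ coeff p n) (coeff-negₚ p n)) (𝔽.-‿inverseˡ _))

  +ₚ-≋[] : ∀ {p q} → q ≋ [] → p +ₚ q ≋ p
  +ₚ-≋[] {p} q≋0 = ≋-trans (+ₚ-cong ≋-refl q≋0) (+ₚ-identityʳ p)

  negₚ-inverseʳ : ∀ p → p +ₚ (-ₚ p) ≋ []
  negₚ-inverseʳ p = ≋-trans (+ₚ-comm p (-ₚ p)) (negₚ-inverseˡ p)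

  +ₚ-interchange : ∀ p q r s → (p +ₚ q) +ₚ (r +ₚ s) ≋ (p +ₚ r) +ₚ (q +ₚ s)
  +ₚ-interchange p q r s = coeffwise go where
    go : ∀ n → coeff ((p +ₚ q) +ₚ (r +ₚ s)) n ≡ coeff ((p +ₚ r) +ₚ (q +ₚ s)) n
    go n rewrite coeff-+ₚ (p +ₚ q) (r +ₚ s) n | coeff-+ₚ p q n | coeff-+ₚ r s n
               | coeff-+ₚ (p +ₚ r) (q +ₚ s) n | coeff-+ₚ p r n | coeff-+ₚ q s n = 𝔽.interchange _ _ _ _

  ·ₚ-distribˡ : ∀ c p q → c ·ₚ (p +ₚ q) ≋ (c ·ₚ p) +ₚ (c ·ₚ q)
  ·ₚ-distribˡ c p q = coeffwise go where
    go : ∀ n → coeff (c ·ₚ (p +ₚ q)) n ≡ coeff ((c ·ₚ p) +ₚ (c ·ₚ q)) n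
    go n rewrite coeff-·ₚ c (p +ₚ q) n | coeff-+ₚ p q n | coeff-+ₚ (c ·ₚ p) (c ·ₚ q) n
               | coeff-·ₚ c p n | coeff-·ₚ c q n = 𝔽.distribˡ _ _ _

  ·ₚ-distribʳ : ∀ c d p → (c 𝔽.+ d) ·ₚ p ≋ (c ·ₚ p) +ₚ (d ·ₚ p)
  ·ₚ-distribʳ c d p = coeffwise go where
    go : ∀ n → coeff ((c 𝔽.+ d) ·ₚ p) n ≡ coeff ((c ·ₚ p) +ₚ (d ·ₚ p)) n
    go n rewrite coeff-·ₚ (c 𝔽.+ d) p n | coeff-+ₚ (c ·ₚ p) (d ·ₚ p) n
               | coeff-·ₚ c p n | coeff-·ₚ d p n = 𝔽.distribʳ _ _ _

  ·ₚ-assoc : ∀ c d p → c ·ₚ (d ·ₚ p) ≋ (c 𝔽.* d) ·ₚ p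
  ·ₚ-assoc c d p = coeffwise go where
    go : ∀ n → coeff (c ·ₚ (d ·ₚ p)) n ≡ coeff ((c 𝔽.* d) ·ₚ p) n
    go n rewrite coeff-·ₚ c (d ·ₚ p) n | coeff-·ₚ d p n | coeff-·ₚ (c 𝔽.* d) p n = sym (𝔽.*-assoc _ _ _)

  0·ₚ : ∀ p → 0# ·ₚ p ≋ []
  0·ₚ p = coeffwise λ n → trans (coeff-·ₚ 0# p n) (𝔽.zeroˡ _)

  1·ₚ : ∀ p → 1# ·ₚ p ≋ p
  1·ₚ p = coeffwise λ n → trans (coeff-·ₚ 1# p n) (𝔽.*-identityˡ _)

  0∷-*ₚ : ∀ p q → (0# ∷ p) *ₚ q ≋ 0# ∷ (p *ₚ q)
  0∷-*ₚ p q = +ₚ-cong (0·ₚ q) ≋-refl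

  *ₚ-zeroˡ : ∀ p q → p ≋ [] → p *ₚ q ≋ []
  *ₚ-zeroˡ []      q p≋0 = ≋-refl
  *ₚ-zeroˡ (a ∷ p) q p≋0 =
    ≋-trans (+ₚ-cong (≋-trans (·ₚ-congʳ (coeff-≡ p≋0 zero)) (0·ₚ q))
                     (∷-cong refl (*ₚ-zeroˡ p q (coeffwise λ n → coeff-≡ p≋0 (suc n)))))
            0∷[]≋[]

  *ₚ-zeroʳ : ∀ p → p *ₚ [] ≋ []
  *ₚ-zeroʳ []      = ≋-refl
  *ₚ-zeroʳ (a ∷ p) = ≋-trans (∷-cong refl (*ₚ-zeroʳ p)) 0∷[]≋[]

  *ₚ-congʳ : ∀ q {p p'} → p ≋ p' → p *ₚ q ≋ p' *ₚ q
  *ₚ-congʳ q {[]}    {p'}     p≋p' = ≋-sym (*ₚ-zeroˡ p' q (≋-sym p≋p'))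
  *ₚ-congʳ q {a ∷ p} {[]}     p≋p' = *ₚ-zeroˡ (a ∷ p) q p≋p'
  *ₚ-congʳ q {a ∷ p} {b ∷ p'} p≋p' =
    +ₚ-cong (·ₚ-congʳ (coeff-≡ p≋p' zero)) (∷-cong refl (*ₚ-congʳ q (∷-injectiveʳ p≋p')))

  *ₚ-distribʳ : ∀ q p p' → (p +ₚ p') *ₚ q ≋ (p *ₚ q) +ₚ (p' *ₚ q)
  *ₚ-distribʳ q []      p'       = ≋-refl
  *ₚ-distribʳ q (a ∷ p) []       = ≋-sym (+ₚ-identityʳ _)
  *ₚ-distribʳ q (a ∷ p) (b ∷ p') =
    ≋-trans (+ₚ-cong (·ₚ-distribʳ a b q) (∷-cong (sym (𝔽.+-identityˡ 0#)) (*ₚ-distribʳ q p p')))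
            (+ₚ-interchange (a ·ₚ q) (b ·ₚ q) (0# ∷ (p *ₚ q)) (0# ∷ (p' *ₚ q)))

  ·ₚ-*ₚ : ∀ c p q → (c ·ₚ p) *ₚ q ≋ c ·ₚ (p *ₚ q)
  ·ₚ-*ₚ c []      q = ≋-refl
  ·ₚ-*ₚ c (a ∷ p) q =
    ≋-trans (+ₚ-cong (≋-sym (·ₚ-assoc c a q)) (∷-cong (sym (𝔽.zeroʳ c)) (·ₚ-*ₚ c p q)))
            (≋-sym (·ₚ-distribˡ c (a ·ₚ q) (0# ∷ (p *ₚ q))))

  *ₚ-assoc : ∀ p q r → (p *ₚ q) *ₚ r ≋ p *ₚ (q *ₚ r)
  *ₚ-assoc []      q r = ≋-refl
  *ₚ-assoc (a ∷ p) q r =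
    ≋-trans (*ₚ-distribʳ r (a ·ₚ q) (0# ∷ (p *ₚ q)))
            (+ₚ-cong (·ₚ-*ₚ a q r) (≋-trans (0∷-*ₚ (p *ₚ q) r) (∷-cong refl (*ₚ-assoc p q r))))

  *ₚ-∷ʳ : ∀ p b q → p *ₚ (b ∷ q) ≋ (b ·ₚ p) +ₚ (0# ∷ (p *ₚ q))
  *ₚ-∷ʳ []      b q = ≋-sym 0∷[]≋[]
  *ₚ-∷ʳ (a ∷ p) b q =
    ∷-cong (cong (𝔽._+ 0#) (𝔽.*-comm a b))
           (≋-trans (+ₚ-cong ≋-refl (*ₚ-∷ʳ p b q)) (+ₚ-swap (a ·ₚ q) (b ·ₚ p) (0# ∷ (p *ₚ q))))
    where
    +ₚ-swap : ∀ x y z → x +ₚ (y +ₚ z) ≋ y +ₚ (x +ₚ z)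
    +ₚ-swap x y z = ≋-trans (≋-sym (+ₚ-assoc x y z))
                            (≋-trans (+ₚ-cong (+ₚ-comm x y) ≋-refl) (+ₚ-assoc y x z))

  *ₚ-comm : ∀ p q → p *ₚ q ≋ q *ₚ p
  *ₚ-comm []      q = ≋-sym (*ₚ-zeroʳ q)
  *ₚ-comm (a ∷ p) q = ≋-trans (+ₚ-cong ≋-refl (∷-cong refl (*ₚ-comm p q))) (≋-sym (*ₚ-∷ʳ q a p))

  *ₚ-identityˡ : ∀ p → 1ₚ *ₚ p ≋ p
  *ₚ-identityˡ p = ≋-trans (+ₚ-cong (1·ₚ p) 0∷[]≋[]) (+ₚ-identityʳ p)

  isCommutativeRingₚ : IsCommutativeRing _≋_ _+ₚ_ _*ₚ_ -ₚ_ 0ₚ 1ₚ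
  isCommutativeRingₚ = record
    { isRing = record
      { +-isAbelianGroup = record
        { isGroup = record
          { isMonoid = record
            { isSemigroup = record
              { isMagma = record
                { isEquivalence = record { refl = ≋-refl ; sym = ≋-sym ; trans = ≋-trans }
                ; ∙-cong = +ₚ-cong }
              ; assoc = +ₚ-assoc }
            ; identity = (λ _ → ≋-refl) , +ₚ-identityʳ }
          ; inverse = negₚ-inverseˡ , negₚ-inverseʳ
          ; ⁻¹-cong = negₚ-cong }
        ; comm = +ₚ-comm }
      ; *-cong = λ {p} {p'} {q} {q'} p≋p' q≋q' →
          ≋-trans (*ₚ-congʳ q p≋p') (≋-trans (*ₚ-comm p' q) (≋-trans (*ₚ-congʳ p' q≋q') (*ₚ-comm q' p')))
      ; *-assoc = *ₚ-assoc
      ; *-identity = *ₚ-identityˡ , (λ p → ≋-trans (*ₚ-comm p 1ₚ) (*ₚ-identityˡ p))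
      ; distrib = (λ p q r → ≋-trans (*ₚ-comm p (q +ₚ r))
                               (≋-trans (*ₚ-distribʳ p q r) (+ₚ-cong (*ₚ-comm q p) (*ₚ-comm r p))))
                , *ₚ-distribʳ }
    ; *-comm = *ₚ-comm }

  polyRing : CommutativeRing 0ℓ 0ℓ
  polyRing = record { isCommutativeRing = isCommutativeRingₚ }

  module R where
    open CommutativeRing polyRing public using (*-congˡ)
    module ≋-Reasoning = Relation.Binary.Reasoning.Setoid (CommutativeRing.setoid polyRing)
    open import Algebra.Properties.Ring (CommutativeRing.ring polyRing) public using (-‿distribˡ-*)
    open IntegerCoefficientSolver polyRing public using (solve; _:=_; _:+_; _:*_; :-_; _:-_; con)

  -- Degrees and leading terms

  record DegreeBelow (p : Poly) (n : ℕ) : Set where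
    constructor degreeBelow
    field vanishesFrom : ∀ i → n ≤ i → coeff p i ≡ 0#
  open DegreeBelow public

  record LeadingTerm (p : Poly) (m : ℕ) (c : Carrier) : Set where
    constructor leadingTerm
    field
      coeff≡lc : coeff p m ≡ c
      lc≢0     : c ≢ 0#
      degree<  : DegreeBelow p (suc m)
  open LeadingTerm public

  HasLeadingTerm : Poly → Set
  HasLeadingTerm p = Σ ℕ λ m → Σ Carrier λ c → LeadingTerm p m c

  degreeBelow-length : ∀ p → DegreeBelow p (length p)
  degreeBelow-length p = degreeBelow (go p) where
    go : ∀ p i → length p ≤ i → coeff p i ≡ 0#
    go []      i       _         = refl
    go (a ∷ p) (suc i) (s≤s p≤i) = go p i p≤i

  degreeBelow-mono : ∀ {p m n} → m ≤ n → DegreeBelow p m → DegreeBelow p n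
  degreeBelow-mono m≤n p<m = degreeBelow λ i n≤i → vanishesFrom p<m i (ℕ.≤-trans m≤n n≤i)

  degreeBelow-resp-≋ : ∀ {p q n} → p ≋ q → DegreeBelow p n → DegreeBelow q n
  degreeBelow-resp-≋ p≋q p<n = degreeBelow λ i n≤i → trans (sym (coeff-≡ p≋q i)) (vanishesFrom p<n i n≤i)

  degreeBelow-zero : ∀ {p} → DegreeBelow p 0 → p ≋ []
  degreeBelow-zero p<0 = coeffwise λ i → vanishesFrom p<0 i z≤n

  ≋[]⇒degreeBelow : ∀ {p n} → p ≋ [] → DegreeBelow p n
  ≋[]⇒degreeBelow p≋0 = degreeBelow λ i _ → coeff-≡ p≋0 i

  degreeBelow-∷ : ∀ {a p n} → DegreeBelow p n → DegreeBelow (a ∷ p) (suc n)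
  degreeBelow-∷ p<n = degreeBelow λ { (suc i) (s≤s n≤i) → vanishesFrom p<n i n≤i }

  degreeBelow-tail : ∀ {a p n} → DegreeBelow (a ∷ p) (suc n) → DegreeBelow p n
  degreeBelow-tail a∷p<n = degreeBelow λ i n≤i → vanishesFrom a∷p<n (suc i) (s≤s n≤i)

  degreeBelow-+ₚ : ∀ {p q n} → DegreeBelow p n → DegreeBelow q n → DegreeBelow (p +ₚ q) n
  degreeBelow-+ₚ {p} {q} p<n q<n = degreeBelow λ i n≤i →
    trans (coeff-+ₚ p q i) (trans (cong₂ 𝔽._+_ (vanishesFrom p<n i n≤i) (vanishesFrom q<n i n≤i)) (𝔽.+-identityˡ 0#))

  degreeBelow-·ₚ : ∀ {p n} c → DegreeBelow p n → DegreeBelow (c ·ₚ p) n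
  degreeBelow-·ₚ {p} c p<n = degreeBelow λ i n≤i →
    trans (coeff-·ₚ c p i) (trans (cong (c 𝔽.*_) (vanishesFrom p<n i n≤i)) (𝔽.zeroʳ c))

  leadingTerm-resp-≋ : ∀ {p q m c} → p ≋ q → LeadingTerm p m c → LeadingTerm q m c
  leadingTerm-resp-≋ p≋q (leadingTerm lc lc≢0 p<) =
    leadingTerm (trans (sym (coeff-≡ p≋q _)) lc) lc≢0 (degreeBelow-resp-≋ p≋q p<)

  leadingTerm⇒≉[] : ∀ {p m c} → LeadingTerm p m c → ¬ p ≋ []
  leadingTerm⇒≉[] (leadingTerm lc lc≢0 _) p≋0 = lc≢0 (trans (sym lc) (coeff-≡ p≋0 _))

  leadingTerm-degree< : ∀ {p m c n} → LeadingTerm p m c → DegreeBelow p n → m < n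
  leadingTerm-degree< {m = m} {n = n} (leadingTerm lc lc≢0 _) p<n with n ℕ.≤? m
  ... | yes n≤m = ⊥-elim (lc≢0 (trans (sym lc) (vanishesFrom p<n m n≤m)))
  ... | no  n≰m = ℕ.≰⇒> n≰m

  leadingTerm-∷ : ∀ {a p m c} → LeadingTerm p m c → LeadingTerm (a ∷ p) (suc m) c
  leadingTerm-∷ (leadingTerm lc lc≢0 p<) = leadingTerm lc lc≢0 (degreeBelow-∷ p<)

  ≋[]⊎leadingTerm : ∀ p → p ≋ [] ⊎ HasLeadingTerm p
  ≋[]⊎leadingTerm []      = inj₁ ≋-refl
  ≋[]⊎leadingTerm (a ∷ p) with ≋[]⊎leadingTerm p
  ... | inj₂ (m , c , p-lead) = inj₂ (suc m , c , leadingTerm-∷ p-lead)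
  ... | inj₁ p≋0 with a ≟ 0#
  ...   | yes a≡0 = inj₁ (≋-trans (∷-cong a≡0 p≋0) 0∷[]≋[])
  ...   | no  a≢0 = inj₂ (0 , a , leadingTerm refl a≢0 (degreeBelow-∷ (≋[]⇒degreeBelow p≋0)))

  leadingTerm-monic : ∀ cs → LeadingTerm (cs ∷ʳ 1#) (length cs) 1#
  leadingTerm-monic []       = leadingTerm refl (λ 1≡0 → 0≢1 (sym 1≡0)) (degreeBelow λ { (suc i) _ → refl })
  leadingTerm-monic (a ∷ cs) = leadingTerm-∷ (leadingTerm-monic cs)

  leadingTerm-+ₚ : ∀ {p q k m c} → DegreeBelow p k → k ≤ m → LeadingTerm q m c → LeadingTerm (p +ₚ q) m c
  leadingTerm-+ₚ {p} {q} {m = m} p<k k≤m (leadingTerm lc lc≢0 q<) =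
    leadingTerm (trans (coeff-+ₚ p q m) (trans (cong₂ 𝔽._+_ (vanishesFrom p<k m k≤m) lc) (𝔽.+-identityˡ _))) lc≢0
                (degreeBelow-+ₚ (degreeBelow-mono (ℕ.m≤n⇒m≤1+n k≤m) p<k) q<)

  leadingTerm-·ₚ : ∀ {a q n d} → a ≢ 0# → LeadingTerm q n d → LeadingTerm (a ·ₚ q) n (a 𝔽.* d)
  leadingTerm-·ₚ {a} {q} {n} a≢0 (leadingTerm lc lc≢0 q<) =
    leadingTerm (trans (coeff-·ₚ a q n) (cong (a 𝔽.*_) lc)) (*-nonzero a≢0 lc≢0) (degreeBelow-·ₚ a q<)

  leadingTerm-*ₚ : ∀ {p q m n c d} → LeadingTerm p m c → LeadingTerm q n d → LeadingTerm (p *ₚ q) (m ℕ.+ n) (c 𝔽.* d)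
  leadingTerm-*ₚ {[]} (leadingTerm lc lc≢0 _) _ = ⊥-elim (lc≢0 (sym lc))
  leadingTerm-*ₚ {a ∷ p} {q} {zero} (leadingTerm refl a≢0 a∷p<1) q-lead =
    leadingTerm-resp-≋ (≋-trans (≋-sym (+ₚ-identityʳ (a ·ₚ q))) (+ₚ-cong ≋-refl (≋-sym 0∷pq≋[])))
                       (leadingTerm-·ₚ a≢0 q-lead)
    where
    0∷pq≋[] : 0# ∷ (p *ₚ q) ≋ []
    0∷pq≋[] = ≋-trans (∷-cong refl (*ₚ-zeroˡ p q (degreeBelow-zero (degreeBelow-tail a∷p<1)))) 0∷[]≋[]
  leadingTerm-*ₚ {a ∷ p} {q} {suc m} {n} (leadingTerm lc lc≢0 a∷p<) q-lead =
    leadingTerm-+ₚ (degreeBelow-·ₚ a (degree< q-lead)) (s≤s (ℕ.m≤n+m n m))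
      (leadingTerm-∷ (leadingTerm-*ₚ (leadingTerm lc lc≢0 (degreeBelow-tail a∷p<)) q-lead))

  -- Divisibility, division with remainder, inverses modulo an irreducible

  open import Algebra.Definitions.RawMagma (RawSemiring.*-rawMagma polyRawSemiring) using (_,_)

  ∣-intro : ∀ {P y} q → q *ₚ P ≋ y → P ∣ y
  ∣-intro q qP≋y = q , ≋⇒≈ₚ qP≋y

  ∣-resp-≋ : ∀ {P y z} → y ≋ z → P ∣ y → P ∣ z
  ∣-resp-≋ {P} {y} y≋z (q , qP≈y) = ∣-intro q (≋-trans (≈ₚ⇒≋ {q *ₚ P} {y} qP≈y) y≋z)

  ∣-refl : ∀ {P} → P ∣ P
  ∣-refl {P} = ∣-intro 1ₚ (*ₚ-identityˡ P)

  ≋[]⇒∣ : ∀ {P y} → y ≋ [] → P ∣ y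
  ≋[]⇒∣ y≋0 = ∣-intro [] (≋-sym y≋0)

  ∣-+ₚ : ∀ {P y z} → P ∣ y → P ∣ z → P ∣ y +ₚ z
  ∣-+ₚ {P} {y} {z} (q , qP≈y) (q' , q'P≈z) =
    ∣-intro (q +ₚ q') (≋-trans (*ₚ-distribʳ P q q') (+ₚ-cong (≈ₚ⇒≋ {q *ₚ P} {y} qP≈y) (≈ₚ⇒≋ {q' *ₚ P} {z} q'P≈z)))

  ∣-*ₚ : ∀ {P y} z → P ∣ y → P ∣ z *ₚ y
  ∣-*ₚ {P} {y} z (q , qP≈y) = ∣-intro (z *ₚ q) (≋-trans (*ₚ-assoc z q P) (R.*-congˡ {z} (≈ₚ⇒≋ {q *ₚ P} {y} qP≈y)))

  ∣-negₚ : ∀ {P y} → P ∣ y → P ∣ -ₚ y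
  ∣-negₚ {P} {y} (q , qP≈y) =
    ∣-intro (-ₚ q) (≋-trans (≋-sym (R.-‿distribˡ-* q P)) (negₚ-cong (≈ₚ⇒≋ {q *ₚ P} {y} qP≈y)))

  ∣-leadingTerm : ∀ {P h d c} → LeadingTerm P d c → P ∣ h → ¬ h ≋ [] → ∃ λ e → Σ Carrier (LeadingTerm h (e ℕ.+ d))
  ∣-leadingTerm {P} {h} P-lead (q , qP≈h) h≉0 with ≋[]⊎leadingTerm q
  ... | inj₁ q≋0 = ⊥-elim (h≉0 (≋-trans (≋-sym (≈ₚ⇒≋ {q *ₚ P} {h} qP≈h)) (*ₚ-zeroˡ q P q≋0)))
  ... | inj₂ (e , _ , q-lead) = e , _ , leadingTerm-resp-≋ (≈ₚ⇒≋ {q *ₚ P} {h} qP≈h) (leadingTerm-*ₚ q-lead P-lead)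

  ∣⇒degree< : ∀ {P h d c n} → LeadingTerm P d c → P ∣ h → ¬ h ≋ [] → DegreeBelow h n → d < n
  ∣⇒degree< P-lead P∣h h≉0 h<n with ∣-leadingTerm P-lead P∣h h≉0
  ... | e , _ , h-lead = ℕ.≤-<-trans (ℕ.m≤n+m _ e) (leadingTerm-degree< h-lead h<n)

  degreeBelow-cancelLeading : ∀ {w r m c c⁻¹} → LeadingTerm r m c → c 𝔽.* c⁻¹ ≡ 1# → DegreeBelow w (suc m) →
                              DegreeBelow (w -ₚ ((coeff w m 𝔽.* c⁻¹) ·ₚ r)) m
  degreeBelow-cancelLeading {w} {r} {m} {c} {c⁻¹} r-lead cc⁻¹≡1 w<m+1 = degreeBelow go
    where
    open ≡.≡-Reasoning
    k = coeff w m 𝔽.* c⁻¹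
    coeff-w-kr : ∀ i → coeff (w -ₚ (k ·ₚ r)) i ≡ coeff w i 𝔽.- k 𝔽.* coeff r i
    coeff-w-kr i = trans (coeff--ₚ w (k ·ₚ r) i) (cong (λ u → coeff w i 𝔽.- u) (coeff-·ₚ k r i))
    kc≡wₘ : k 𝔽.* c ≡ coeff w m
    kc≡wₘ = begin
      (coeff w m 𝔽.* c⁻¹) 𝔽.* c   ≡⟨ 𝔽.*-assoc _ c⁻¹ c ⟩
      coeff w m 𝔽.* (c⁻¹ 𝔽.* c)   ≡⟨ cong (coeff w m 𝔽.*_) (trans (𝔽.*-comm c⁻¹ c) cc⁻¹≡1) ⟩
      coeff w m 𝔽.* 1#            ≡⟨ 𝔽.*-identityʳ _ ⟩
      coeff w m                   ∎
    go : ∀ i → m ≤ i → coeff (w -ₚ (k ·ₚ r)) i ≡ 0#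
    go i m≤i with ℕ.m≤n⇒m<n∨m≡n m≤i
    ... | inj₁ m<i = begin
      coeff (w -ₚ (k ·ₚ r)) i          ≡⟨ coeff-w-kr i ⟩
      coeff w i 𝔽.- k 𝔽.* coeff r i    ≡⟨ cong₂ (λ u v → u 𝔽.- k 𝔽.* v) (vanishesFrom w<m+1 i m<i)
                                                                        (vanishesFrom (degree< r-lead) i m<i) ⟩
      0# 𝔽.- k 𝔽.* 0#                  ≡⟨ cong (λ u → 0# 𝔽.- u) (𝔽.zeroʳ k) ⟩
      0# 𝔽.- 0#                        ≡⟨ 𝔽.-‿inverseʳ 0# ⟩
      0#                               ∎
    ... | inj₂ refl = begin
      coeff (w -ₚ (k ·ₚ r)) m          ≡⟨ coeff-w-kr m ⟩
      coeff w m 𝔽.- k 𝔽.* coeff r m    ≡⟨ cong (λ v → coeff w m 𝔽.- k 𝔽.* v) (coeff≡lc r-lead) ⟩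
      coeff w m 𝔽.- k 𝔽.* c            ≡⟨ cong (λ u → coeff w m 𝔽.- u) kc≡wₘ ⟩
      coeff w m 𝔽.- coeff w m          ≡⟨ 𝔽.-‿inverseʳ _ ⟩
      0#                               ∎

  divMod : ∀ {r m c} → LeadingTerm r m c → ∀ p →
           Σ Poly λ s → Σ Poly λ t → p ≋ (s *ₚ r) +ₚ t × DegreeBelow t m
  divMod r-lead [] = [] , [] , ≋-refl , degreeBelow λ _ _ → refl
  divMod {r} {m} {c} r-lead (a ∷ p) with divMod r-lead p | inverse c (lc≢0 r-lead)
  ... | s , t , p≋sr+t , t<m | c⁻¹ , cc⁻¹≡1 =
    k ∷ s , (a ∷ t) -ₚ (k ·ₚ r) , a∷p≋ , degreeBelow-cancelLeading r-lead cc⁻¹≡1 (degreeBelow-∷ t<m)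
    where
    k = coeff (a ∷ t) m 𝔽.* c⁻¹
    rearrange : ∀ x y z → (x +ₚ y) +ₚ (z -ₚ x) ≋ y +ₚ z
    rearrange = R.solve 3 (λ x y z → (x R.:+ y) R.:+ (z R.:- x) R.:= y R.:+ z) ≋-refl
    a∷p≋ : a ∷ p ≋ ((k ∷ s) *ₚ r) +ₚ ((a ∷ t) -ₚ (k ·ₚ r))
    a∷p≋ = ≋-trans (∷-cong (sym (𝔽.+-identityˡ a)) p≋sr+t) (≋-sym (rearrange (k ·ₚ r) (0# ∷ (s *ₚ r)) (a ∷ t)))

  module _ {P d c} (P-lead : LeadingTerm P d c) (P-irr : Irreducible P) (y : Poly) where

    private
      sub-≋[] : ∀ {p q} → p ≋ q → p -ₚ q ≋ []
      sub-≋[] {q = q} p≋q = ≋-trans (+ₚ-cong p≋q ≋-refl) (negₚ-inverseʳ q)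

      unit-multiple⇒invertibleMod : ∀ r u e → P ∣ r -ₚ u *ₚ y → e *ₚ r ≋ 1ₚ → P ∣ y *ₚ (e *ₚ u) -ₚ 1ₚ
      unit-multiple⇒invertibleMod r u e P∣r-uy er≋1 =
        ∣-resp-≋ (identity r u e) (∣-+ₚ (∣-*ₚ (-ₚ e) P∣r-uy) (≋[]⇒∣ (sub-≋[] er≋1)))
        where
        identity : ∀ r u e → ((-ₚ e) *ₚ (r -ₚ u *ₚ y)) +ₚ (e *ₚ r -ₚ 1ₚ) ≋ y *ₚ (e *ₚ u) -ₚ 1ₚ
        identity r u e = R.solve 4 (λ r u e y → ((R.:- e) R.:* (r R.:- u R.:* y)) R.:+ (e R.:* r R.:- R.con (+ 1))
                                            R.:= y R.:* (e R.:* u) R.:- R.con (+ 1)) ≋-refl r u e y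

    -- Euclid's algorithm: r ≡ u y (mod P) is replaced by the remainder of P
    -- modulo r, until r divides P; then r is a unit since P is irreducible.
    invertibleMod-descent : ∀ k r u → DegreeBelow r k → DegreeBelow r d → ¬ r ≋ [] →
                            P ∣ r -ₚ u *ₚ y → ∃ λ v → P ∣ y *ₚ v -ₚ 1ₚ
    invertibleMod-descent zero    r u r<0 r<d r≉0 _ = ⊥-elim (r≉0 (degreeBelow-zero r<0))
    invertibleMod-descent (suc k) r u r<k r<d r≉0 P∣r-uy with ≋[]⊎leadingTerm r
    ... | inj₁ r≋0 = ⊥-elim (r≉0 r≋0)
    ... | inj₂ (m , _ , r-lead) with divMod r-lead P
    ...   | s , t , P≋sr+t , t<m with ≋[]⊎leadingTerm t
    ...     | inj₂ (_ , _ , t-lead) =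
                invertibleMod-descent k t (-ₚ (s *ₚ u))
                  (degreeBelow-mono (ℕ.≤-pred (leadingTerm-degree< r-lead r<k)) t<m)
                  (degreeBelow-mono (ℕ.<⇒≤ (leadingTerm-degree< r-lead r<d)) t<m)
                  (leadingTerm⇒≉[] t-lead)
                  (∣-resp-≋ (identity s r t u y) (∣-+ₚ (∣-resp-≋ P≋sr+t ∣-refl) (∣-*ₚ (-ₚ s) P∣r-uy)))
      where
      identity : ∀ s r t u y → ((s *ₚ r) +ₚ t) +ₚ ((-ₚ s) *ₚ (r -ₚ u *ₚ y)) ≋ t -ₚ (-ₚ (s *ₚ u)) *ₚ y
      identity = R.solve 5 (λ s r t u y → ((s R.:* r) R.:+ t) R.:+ ((R.:- s) R.:* (r R.:- u R.:* y))
                                           R.:= t R.:- (R.:- (s R.:* u)) R.:* y) ≋-refl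
    ...     | inj₁ t≋0 with Irreducible.split-∣1 P-irr (≋⇒≈ₚ (≋-trans P≋sr+t (+ₚ-≋[] t≋0)))
    ...       | inj₂ (e , er≈1) = e *ₚ u , unit-multiple⇒invertibleMod r u e P∣r-uy (≈ₚ⇒≋ {e *ₚ r} {1ₚ} er≈1)
    ...       | inj₁ (e , es≈1) = ⊥-elim (ℕ.<-irrefl refl (∣⇒degree< P-lead P∣r r≉0 r<d))
      where
      open R.≋-Reasoning
      P∣r : P ∣ r
      P∣r = ∣-intro e (begin
        e *ₚ P           ≈⟨ R.*-congˡ {e} (≋-trans P≋sr+t (+ₚ-≋[] t≋0)) ⟩
        e *ₚ (s *ₚ r)    ≈⟨ ≋-sym (*ₚ-assoc e s r) ⟩
        (e *ₚ s) *ₚ r    ≈⟨ *ₚ-congʳ r (≈ₚ⇒≋ {e *ₚ s} {1ₚ} es≈1) ⟩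
        1ₚ *ₚ r          ≈⟨ *ₚ-identityˡ r ⟩
        r                ∎)

    invertibleMod : ¬ P ∣ y → ∃ λ v → P ∣ y *ₚ v -ₚ 1ₚ
    invertibleMod P∤y with divMod P-lead y
    ... | s , t , y≋sP+t , t<d with ≋[]⊎leadingTerm t
    ...   | inj₁ t≋0 = ⊥-elim (P∤y (∣-intro s (≋-sym (≋-trans y≋sP+t (+ₚ-≋[] t≋0)))))
    ...   | inj₂ (_ , _ , t-lead) = invertibleMod-descent d t 1ₚ t<d t<d (leadingTerm⇒≉[] t-lead) P∣t-y
      where
      identity : ∀ s P t → (-ₚ s) *ₚ P ≋ t -ₚ 1ₚ *ₚ ((s *ₚ P) +ₚ t)
      identity = R.solve 3 (λ s P t → (R.:- s) R.:* P R.:= t R.:- R.con (+ 1) R.:* ((s R.:* P) R.:+ t)) ≋-refl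
      P∣t-y : P ∣ t -ₚ 1ₚ *ₚ y
      P∣t-y = ∣-intro (-ₚ s)
        (≋-trans (identity s P t) (+ₚ-cong ≋-refl (negₚ-cong (R.*-congˡ {1ₚ} (≋-sym y≋sP+t)))))

  -- Clearing denominators

  commonDenominator : List Frac → Poly
  commonDenominator []      = 1ₚ
  commonDenominator (k ∷ f) = den k *ₚ commonDenominator f

  -- commonDenominator f · f(x), computed in R by a Horner scheme
  clearedValue : List Frac → Poly → Poly
  clearedValue []      x = []
  clearedValue (k ∷ f) x = (commonDenominator f *ₚ num k) +ₚ (x *ₚ (den k *ₚ clearedValue f x))

  clearedValue-≡-mod : ∀ {P} f cs x → Pointwise (RepMod P) f cs →
                       P ∣ (commonDenominator f *ₚ horner cs x) -ₚ clearedValue f x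
  clearedValue-≡-mod []      []       x []               = ≋[]⇒∣ 0∷[]≋[]
  clearedValue-≡-mod (k ∷ f) (c ∷ cs) x (dc≡n ∷ f≡cs) =
    ∣-resp-≋ (identity (den k) (commonDenominator f) c x (horner cs x) (num k) (clearedValue f x))
             (∣-+ₚ (∣-*ₚ (commonDenominator f) dc≡n) (∣-*ₚ (x *ₚ den k) (clearedValue-≡-mod f cs x f≡cs)))
    where
    identity : ∀ d D c x h n v → (D *ₚ ((d *ₚ c) -ₚ n)) +ₚ ((x *ₚ d) *ₚ ((D *ₚ h) -ₚ v))
                                ≋ ((d *ₚ D) *ₚ (c +ₚ (x *ₚ h))) -ₚ ((D *ₚ n) +ₚ (x *ₚ (d *ₚ v)))
    identity = R.solve 7 (λ d D c x h n v →
        (D R.:* ((d R.:* c) R.:- n)) R.:+ ((x R.:* d) R.:* ((D R.:* h) R.:- v))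
      R.:= ((d R.:* D) R.:* (c R.:+ (x R.:* h))) R.:- ((D R.:* n) R.:+ (x R.:* (d R.:* v)))) ≋-refl

  horner-≡-mod : ∀ {P} cs y z → P ∣ y -ₚ z → P ∣ horner cs y -ₚ horner cs z
  horner-≡-mod []       y z P∣y-z = ≋[]⇒∣ ≋-refl
  horner-≡-mod (c ∷ cs) y z P∣y-z =
    ∣-resp-≋ (identity c y z (horner cs y) (horner cs z))
             (∣-+ₚ (∣-*ₚ y (horner-≡-mod cs y z P∣y-z)) (∣-*ₚ (horner cs z) P∣y-z))
    where
    identity : ∀ c y z hy hz → (y *ₚ (hy -ₚ hz)) +ₚ (hz *ₚ (y -ₚ z)) ≋ (c +ₚ (y *ₚ hy)) -ₚ (c +ₚ (z *ₚ hz))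
    identity = R.solve 5 (λ c y z hy hz → (y R.:* (hy R.:- hz)) R.:+ (hz R.:* (y R.:- z))
                            R.:= (c R.:+ (y R.:* hy)) R.:- (c R.:+ (z R.:* hz))) ≋-refl

  den≉[] : ∀ k → ¬ den k ≋ []
  den≉[] k den≋0 = den≉0 k (≋⇒≈ₚ den≋0)

  den-leadingTerm : ∀ k → HasLeadingTerm (den k)
  den-leadingTerm k with ≋[]⊎leadingTerm (den k)
  ... | inj₁ den≋0    = ⊥-elim (den≉[] k den≋0)
  ... | inj₂ den-lead = den-lead

  commonDenominator-leadingTerm : ∀ f → HasLeadingTerm (commonDenominator f)
  commonDenominator-leadingTerm []      = 0 , 1# , leadingTerm-monic []
  commonDenominator-leadingTerm (k ∷ f) with den-leadingTerm k | commonDenominator-leadingTerm f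
  ... | _ , _ , den-lead | _ , _ , D-lead = _ , _ , leadingTerm-*ₚ den-lead D-lead

  *ₚ≋[]⇒≋[]ʳ : ∀ {p q} → HasLeadingTerm p → p *ₚ q ≋ [] → q ≋ []
  *ₚ≋[]⇒≋[]ʳ {q = q} (_ , _ , p-lead) pq≋0 with ≋[]⊎leadingTerm q
  ... | inj₁ q≋0              = q≋0
  ... | inj₂ (_ , _ , q-lead) = ⊥-elim (leadingTerm⇒≉[] (leadingTerm-*ₚ p-lead q-lead) pq≋0)

  degreeBound : List Frac → ℕ
  degreeBound []      = 0
  degreeBound (k ∷ f) = length (commonDenominator f *ₚ num k) ⊔ degreeBound f

  -- Beyond degreeBound f the term of highest degree in x dominates clearedValue f x.
  clearedValue-≉[] : ∀ {f x m c} → NonzeroKPoly f → LeadingTerm x m c → degreeBound f ≤ m → ¬ clearedValue f x ≋ []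
  clearedValue-≉[] {k ∷ f} {x} {m} f≢0 x-lead f≤m vanishes with ≋[]⊎leadingTerm (clearedValue f x)
  ... | inj₂ (_ , _ , v-lead) =
    leadingTerm⇒≉[] (leadingTerm-+ₚ A<m (ℕ.m≤m+n m _) (leadingTerm-*ₚ x-lead (leadingTerm-*ₚ den-lead v-lead)))
                    vanishes
    where
    A<m : DegreeBelow (commonDenominator f *ₚ num k) m
    A<m = degreeBelow-mono (ℕ.≤-trans (ℕ.m≤m⊔n _ (degreeBound f)) f≤m) (degreeBelow-length _)
    den-lead = proj₂ (proj₂ (den-leadingTerm k))
  ... | inj₁ v≋0 with f≢0
  ...   | there f'≢0 = clearedValue-≉[] f'≢0 x-lead (ℕ.≤-trans (ℕ.m≤n⊔m _ (degreeBound f)) f≤m) v≋0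
  ...   | here num≉0 = num≉0 (≋⇒≈ₚ (*ₚ≋[]⇒≋[]ʳ (commonDenominator-leadingTerm f) A≋0))
    where
    A≋0 : commonDenominator f *ₚ num k ≋ []
    A≋0 = ≋-trans (≋-sym (+ₚ-≋[] (≋-trans (R.*-congˡ {x} (R.*-congˡ {den k} v≋0))
                                          (≋-trans (R.*-congˡ {x} (*ₚ-zeroʳ (den k))) (*ₚ-zeroʳ x)))))
                  vanishes

  reductionsMod : ∀ {P d c} → LeadingTerm P d c → Irreducible P →
                  ∀ f → All (λ k → ¬ P ∣ den k) f → ∃ (Pointwise (RepMod P) f)
  reductionsMod P-lead P-irr []      []               = [] , []
  reductionsMod P-lead P-irr (k ∷ f) (P∤den ∷ P∤dens) with invertibleMod P-lead P-irr (den k) P∤den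
  ... | v , P∣dv-1 =
    v *ₚ num k ∷ proj₁ rest , ∣-resp-≋ (identity (den k) v (num k)) (∣-*ₚ (num k) P∣dv-1) ∷ proj₂ rest
    where
    rest = reductionsMod P-lead P-irr f P∤dens
    identity : ∀ d v n → n *ₚ ((d *ₚ v) -ₚ 1ₚ) ≋ (d *ₚ (v *ₚ n)) -ₚ n
    identity = R.solve 3 (λ d v n → n R.:* ((d R.:* v) R.:- R.con (+ 1)) R.:= (d R.:* (v R.:* n)) R.:- n) ≋-refl

  ∣u∣u-v⇒∣v : ∀ {P u v} → P ∣ u → P ∣ u -ₚ v → P ∣ v
  ∣u∣u-v⇒∣v {u = u} {v} P∣u P∣u-v = ∣-resp-≋ (identity u v) (∣-+ₚ P∣u (∣-negₚ P∣u-v))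
    where
    identity : ∀ u v → u -ₚ (u -ₚ v) ≋ v
    identity = R.solve 2 (λ u v → u R.:- (u R.:- v) R.:= v) ≋-refl

  vanishesAt⇒∣clearedValue : ∀ {f a x P cs} → VanishesAt f a P → CongMod a x P → Pointwise (RepMod P) f cs →
                             P ∣ clearedValue f x
  vanishesAt⇒∣clearedValue {f} {a} {x} {P} {cs} f[aP]≡0 aP≡x f≡cs =
    ∣u∣u-v⇒∣v (∣-*ₚ (commonDenominator f) P∣f[x]) (clearedValue-≡-mod f cs x f≡cs)
    where
    P∣f[x] : P ∣ horner cs x
    P∣f[x] = ∣u∣u-v⇒∣v (f[aP]≡0 cs f≡cs) (horner-≡-mod cs (a P) x aP≡x)

  monic⇒leadingTerm : ∀ {P} → Monic P → ∃ λ d → LeadingTerm P d 1#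
  monic⇒leadingTerm (cs , refl) = length cs , leadingTerm-monic cs

  monic-∣⇒length≤ : ∀ {P h} → Monic P → P ∣ h → ¬ h ≋ [] → length P ≤ length h
  monic-∣⇒length≤ {h = h} (cs , refl) P∣h h≉0 rewrite length-++ cs {1# ∷ []} | ℕ.+-comm (length cs) 1 =
    ∣⇒degree< (leadingTerm-monic cs) P∣h h≉0 (degreeBelow-length h)

  maxDenominatorLength : List Frac → ℕ
  maxDenominatorLength []      = 0
  maxDenominatorLength (k ∷ f) = length (den k) ⊔ maxDenominatorLength f

  long-monic∤denominators : ∀ {P} → Monic P → ∀ f → maxDenominatorLength f < length P → All (λ k → ¬ P ∣ den k) f
  long-monic∤denominators P-monic []      _ = []
  long-monic∤denominators P-monic (k ∷ f) f<P =
      (λ P∣den → ℕ.<⇒≱ f<P (ℕ.≤-trans (monic-∣⇒length≤ P-monic P∣den (den≉[] k)) (ℕ.m≤m⊔n _ _)))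
    ∷ long-monic∤denominators P-monic f (ℕ.≤-<-trans (ℕ.m≤n⊔m _ _) f<P)

  polysOfLength≤ : ℕ → List Poly
  polysOfLength≤ zero    = [] ∷ []
  polysOfLength≤ (suc n) = [] ∷ cartesianProductWith _∷_ elements (polysOfLength≤ n)

  ∈-polysOfLength≤ : ∀ {n} p → length p ≤ n → p ∈ polysOfLength≤ n
  ∈-polysOfLength≤ {zero}  []      _         = here refl
  ∈-polysOfLength≤ {suc n} []      _         = here refl
  ∈-polysOfLength≤ {suc n} (a ∷ p) (s≤s p≤n) =
    there (∈-cartesianProductWith⁺ _∷_ (complete a) (∈-polysOfLength≤ p p≤n))

  degreeBelow⇒≋short : ∀ {p n} → DegreeBelow p n → ∃ λ q → length q ≤ n × p ≋ q
  degreeBelow⇒≋short {[]}    {n}     _   = [] , z≤n , ≋-refl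
  degreeBelow⇒≋short {a ∷ p} {zero}  p<0 = [] , z≤n , degreeBelow-zero p<0
  degreeBelow⇒≋short {a ∷ p} {suc n} p<n with degreeBelow⇒≋short (degreeBelow-tail p<n)
  ... | q , q≤n , p≋q = a ∷ q , s≤s q≤n , ∷-cong refl p≋q

  degreeBelow⇒≈-polysOfLength≤ : ∀ {p n} → DegreeBelow p n → Any (p ≈ₚ_) (polysOfLength≤ n)
  degreeBelow⇒≈-polysOfLength≤ p<n with degreeBelow⇒≋short p<n
  ... | q , q≤n , p≋q = Any.map (λ { refl → ≋⇒≈ₚ p≋q }) (∈-polysOfLength≤ q q≤n)

  degreeBelow⊎leadingTerm : ∀ p n → DegreeBelow p n ⊎ Σ ℕ λ m → n ≤ m × Σ Carrier (LeadingTerm p m)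
  degreeBelow⊎leadingTerm p n with ≋[]⊎leadingTerm p
  ... | inj₁ p≋0 = inj₁ (≋[]⇒degreeBelow p≋0)
  ... | inj₂ (m , c , p-lead) with m ℕ.<? n
  ...   | yes m<n = inj₁ (degreeBelow-mono m<n (degree< p-lead))
  ...   | no  m≮n = inj₂ (m , ℕ.≮⇒≥ m≮n , c , p-lead)

  congruentPrimes-finite : ∀ {a f x m c} → NonzeroKPoly f → RootInA f a → LeadingTerm x m c → degreeBound f ≤ m →
                           FiniteSetOfPrimes (λ P → MonicIrreducible P × CongMod a x P)
  congruentPrimes-finite {a} {f} {x} f≢0 (E , root) x-lead f≤m = E ++ polysOfLength≤ N , covers
    where
    N = length (clearedValue f x) ⊔ maxDenominatorLength f
    covers : ∀ P → MonicIrreducible P × CongMod a x P → P ∈ E ++ polysOfLength≤ N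
    covers P ((P-monic , P-irr) , aP≡x) with length P ℕ.≤? N | P ∈? E
    ... | yes P≤N | _     = ∈-++⁺ʳ E (∈-polysOfLength≤ P P≤N)
    ... | no _    | yes P∈E = ∈-++⁺ˡ P∈E
    ... | no P≰N  | no P∉E with reductionsMod (proj₂ (monic⇒leadingTerm P-monic)) P-irr f
                                  (long-monic∤denominators P-monic f (ℕ.≤-<-trans (ℕ.m≤n⊔m _ _) (ℕ.≰⇒> P≰N)))
    ...   | cs , f≡cs = ⊥-elim (P≰N (ℕ.≤-trans (monic-∣⇒length≤ P-monic P∣f[x] (clearedValue-≉[] f≢0 x-lead f≤m))
                                                (ℕ.m≤m⊔n _ _)))
      where
      P∣f[x] : P ∣ clearedValue f x
      P∣f[x] = vanishesAt⇒∣clearedValue {a = a} (root P (P-monic , P-irr) P∉E) aP≡x f≡cs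

proposition5p10 : (F : FiniteField) → let open Over F in
    (a : Family) → AlgebraicOverK a →
    FiniteSetInR (λ x → InfiniteSetOfPrimes (λ P → MonicIrreducible P × CongMod a x P))
proposition5p10 F a (f , f≢0 , a-root) = polysOfLength≤ (degreeBound f) , persistent⇒short
  where
  open Over F
  open PolynomialsOver F
  persistent⇒short : ∀ x → InfiniteSetOfPrimes (λ P → MonicIrreducible P × CongMod a x P) →
                     Any (x ≈ₚ_) (polysOfLength≤ (degreeBound f))
  persistent⇒short x infinite with degreeBelow⊎leadingTerm x (degreeBound f)
  ... | inj₁ x<B                    = degreeBelow⇒≈-polysOfLength≤ x<B
  ... | inj₂ (m , B≤m , c , x-lead) = ⊥-elim (infinite (congruentPrimes-finite f≢0 a-root x-lead B≤m))
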